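{- For every formula $\varphi\in\mathcal{L}^{\Box}$: $\varphi$ is derivable in $\mathsf{ConstCK}$ if and only if $\varphi$ is derivable in $\mathsf{ConstCK}^{\Box}$.
   Context: Language $\mathcal{L}$: formulas $\varphi ::= p \mid \bot \mid \varphi\wedge\varphi \mid \varphi\vee\varphi \mid \varphi\to\varphi \mid \varphi \mathbin{\Box\!\!\rightarrow} \varphi \mid \varphi \mathbin{\Diamond\!\!\rightarrow}\varphi$; $\mathcal{L}^{\Box}$ is the sublanguage without $\mathbin{\Diamond\!\!\rightarrow}$. $\wedge,\vee$ bind more strongly than $\to,\mathbin{\Box\!\!\rightarrow},\mathbin{\Diamond\!\!\rightarrow}$; $\neg\varphi:=\varphi\to\bot$, $\top:=\neg\bot$, $\varphi\leftrightarrow\psi:=(\varphi\to\psi)\wedge(\psi\to\varphi)$. Axioms/rules: CM$_\Box$: $(\varphi\mathbin{\Box\!\!\rightarrow}\psi\wedge\chi)\to(\varphi\mathbin{\Box\!\!\rightarrow}\psi)\wedge(\varphi\mathbin{\Box\!\!\rightarrow}\chi)$; CC$_\Box$: $(\varphi\mathbin{\Box\!\!\rightarrow}\psi)\wedge(\varphi\mathbin{\Box\!\!\rightarrow}\chi)\to(\varphi\mathbin{\Box\!\!\rightarrow}\psi\wedge\chi)$; CN$_\Box$: $\varphi\mathbin{\Box\!\!\rightarrow}\top$; CN$_\Diamond$: $\neg(\varphi\mathbin{\Diamond\!\!\rightarrow}\bot)$; CK$_\Diamond$: $(\varphi\mathbin{\Box\!\!\rightarrow}(\psi\to\chi))\to((\varphi\mathbin{\Diamond\!\!\rightarrow}\psi)\to(\varphi\mathbin{\Diamond\!\!\rightarrow}\chi))$;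 RA$_\Box$: from $\varphi\leftrightarrow\rho$ infer $(\varphi\mathbin{\Box\!\!\rightarrow}\psi)\leftrightarrow(\rho\mathbin{\Box\!\!\rightarrow}\psi)$; RC$_\Box$: from $\psi\leftrightarrow\chi$ infer $(\varphi\mathbin{\Box\!\!\rightarrow}\psi)\leftrightarrow(\varphi\mathbin{\Box\!\!\rightarrow}\chi)$; RA$_\Diamond$, RC$_\Diamond$ the same with $\mathbin{\Diamond\!\!\rightarrow}$. $\mathsf{ConstCK}^{\Box}$ (Weiss' logic): in language $\mathcal{L}^\Box$, intuitionistic propositional logic with modus ponens plus RA$_\Box$, RC$_\Box$, CM$_\Box$, CC$_\Box$, CN$_\Box$. $\mathsf{ConstCK}$: in language $\mathcal{L}$, intuitionistic propositional logic with modus ponens plus CM$_\Box$, CC$_\Box$, CN$_\Box$, CN$_\Diamond$, CK$_\Diamond$, RA$_\Box$, RC$_\Box$, RA$_\Diamond$, RC$_\Diamond$. -}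

module Defs where

open import Data.Nat using (ℕ)

infixr 6 _∧_
infixr 5 _∨_
infixr 4 _⇒_ _□→_ _◇→_

data Fm : Set where
  var  : ℕ → Fm
  ⊥'   : Fm
  _∧_  : Fm → Fm → Fm
  _∨_  : Fm → Fm → Fm
  _⇒_  : Fm → Fm → Fm
  _□→_ : Fm → Fm → Fm
  _◇→_ : Fm → Fm → Fm

data FmB : Set where
  var  : ℕ → FmB
  ⊥'   : FmB
  _∧_  : FmB → FmB → FmB
  _∨_  : FmB → FmB → FmB
  _⇒_  : FmB → FmB → FmB
  _□→_ : FmB → FmB → FmB

ι : FmB → Fm
ι (var p)  = var p
ι ⊥'       = ⊥'
ι (a ∧ b)  = ι a ∧ ι b
ι (a ∨ b)  = ι a ∨ ι b
ι (a ⇒ b)  = ι a ⇒ ι b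
ι (a □→ b) = ι a □→ ι b

¬' : Fm → Fm
¬' a = a ⇒ ⊥'

⊤' : Fm
⊤' = ¬' ⊥'

_⇔_ : Fm → Fm → Fm
a ⇔ b = (a ⇒ b) ∧ (b ⇒ a)

¬B : FmB → FmB
¬B a = a ⇒ ⊥'

⊤B : FmB
⊤B = ¬B ⊥'

_⇔B_ : FmB → FmB → FmB
a ⇔B b = (a ⇒ b) ∧ (b ⇒ a)

data ⊢CK : Fm → Set where
  K    : ∀ {a b} → ⊢CK (a ⇒ b ⇒ a)
  S    : ∀ {a b c} → ⊢CK ((a ⇒ b ⇒ c) ⇒ (a ⇒ b) ⇒ a ⇒ c)
  ∧E₁  : ∀ {a b} → ⊢CK (a ∧ b ⇒ a)
  ∧E₂  : ∀ {a b} → ⊢CK (a ∧ b ⇒ b)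
  ∧I   : ∀ {a b} → ⊢CK (a ⇒ b ⇒ a ∧ b)
  ∨I₁  : ∀ {a b} → ⊢CK (a ⇒ a ∨ b)
  ∨I₂  : ∀ {a b} → ⊢CK (b ⇒ a ∨ b)
  ∨E   : ∀ {a b c} → ⊢CK ((a ⇒ c) ⇒ (b ⇒ c) ⇒ a ∨ b ⇒ c)
  ⊥E   : ∀ {a} → ⊢CK (⊥' ⇒ a)
  MP   : ∀ {a b} → ⊢CK (a ⇒ b) → ⊢CK a → ⊢CK b
  CM□  : ∀ {a b c} → ⊢CK ((a □→ b ∧ c) ⇒ (a □→ b) ∧ (a □→ c))
  CC□  : ∀ {a b c} → ⊢CK ((a □→ b) ∧ (a □→ c) ⇒ (a □→ b ∧ c))
  CN□  : ∀ {a} → ⊢CK (a □→ ⊤')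
  CN◇  : ∀ {a} → ⊢CK (¬' (a ◇→ ⊥'))
  CK◇  : ∀ {a b c} → ⊢CK ((a □→ (b ⇒ c)) ⇒ (a ◇→ b) ⇒ (a ◇→ c))
  RA□  : ∀ {a r b} → ⊢CK (a ⇔ r) → ⊢CK ((a □→ b) ⇔ (r □→ b))
  RC□  : ∀ {a b c} → ⊢CK (b ⇔ c) → ⊢CK ((a □→ b) ⇔ (a □→ c))
  RA◇  : ∀ {a r b} → ⊢CK (a ⇔ r) → ⊢CK ((a ◇→ b) ⇔ (r ◇→ b))
  RC◇  : ∀ {a b c} → ⊢CK (b ⇔ c) → ⊢CK ((a ◇→ b) ⇔ (a ◇→ c))

data ⊢CK□ : FmB → Set where
  K    : ∀ {a b} → ⊢CK□ (a ⇒ b ⇒ a)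
  S    : ∀ {a b c} → ⊢CK□ ((a ⇒ b ⇒ c) ⇒ (a ⇒ b) ⇒ a ⇒ c)
  ∧E₁  : ∀ {a b} → ⊢CK□ (a ∧ b ⇒ a)
  ∧E₂  : ∀ {a b} → ⊢CK□ (a ∧ b ⇒ b)
  ∧I   : ∀ {a b} → ⊢CK□ (a ⇒ b ⇒ a ∧ b)
  ∨I₁  : ∀ {a b} → ⊢CK□ (a ⇒ a ∨ b)
  ∨I₂  : ∀ {a b} → ⊢CK□ (b ⇒ a ∨ b)
  ∨E   : ∀ {a b c} → ⊢CK□ ((a ⇒ c) ⇒ (b ⇒ c) ⇒ a ∨ b ⇒ c)
  ⊥E   : ∀ {a} → ⊢CK□ (⊥' ⇒ a)
  MP   : ∀ {a b} → ⊢CK□ (a ⇒ b) → ⊢CK□ a → ⊢CK□ b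
  CM□  : ∀ {a b c} → ⊢CK□ ((a □→ b ∧ c) ⇒ (a □→ b) ∧ (a □→ c))
  CC□  : ∀ {a b c} → ⊢CK□ ((a □→ b) ∧ (a □→ c) ⇒ (a □→ b ∧ c))
  CN□  : ∀ {a} → ⊢CK□ (a □→ ⊤B)
  RA□  : ∀ {a r b} → ⊢CK□ (a ⇔B r) → ⊢CK□ ((a □→ b) ⇔B (r □→ b))
  RC□  : ∀ {a b c} → ⊢CK□ (b ⇔B c) → ⊢CK□ ((a □→ b) ⇔B (a □→ c))

-- Reading every conditional a ◇→ b as ⊥ turns each ◇-axiom and ◇-rule of ConstCK into
-- a ConstCK□-theorem (¬⊥, _ ⇒ ⊥ ⇒ ⊥, ⊥ ⇔ ⊥) and leaves the rest of the system unchanged,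
-- so it maps ConstCK-theorems to ConstCK□-theorems; on □-formulas it is the identity.
-- Conversely every axiom and rule of ConstCK□ is one of ConstCK.
module Submission where

open import Defs
open import Data.Product using (_×_; _,_)
open import Relation.Binary.PropositionalEquality using (_≡_; refl; cong₂; subst)

erase◇ : Fm → FmB
erase◇ (var p)  = var p
erase◇ ⊥'       = ⊥'
erase◇ (a ∧ b)  = erase◇ a ∧ erase◇ b
erase◇ (a ∨ b)  = erase◇ a ∨ erase◇ b
erase◇ (a ⇒ b)  = erase◇ a ⇒ erase◇ b
erase◇ (a □→ b) = erase◇ a □→ erase◇ b
erase◇ (a ◇→ b) = ⊥'

erase◇-ι : ∀ φ → erase◇ (ι φ) ≡ φ
erase◇-ι (var p)  = refl
erase◇-ι ⊥'       = refl
erase◇-ι (a ∧ b)  = cong₂ _∧_ (erase◇-ι a) (erase◇-ι b)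
erase◇-ι (a ∨ b)  = cong₂ _∨_ (erase◇-ι a) (erase◇-ι b)
erase◇-ι (a ⇒ b)  = cong₂ _⇒_ (erase◇-ι a) (erase◇-ι b)
erase◇-ι (a □→ b) = cong₂ _□→_ (erase◇-ι a) (erase◇-ι b)

⇒-refl : ∀ {a} → ⊢CK□ (a ⇒ a)
⇒-refl {a} = MP (MP S K) (K {a} {a ⇒ a})

⇔-refl : ∀ {a} → ⊢CK□ (a ⇔B a)
⇔-refl = MP (MP ∧I ⇒-refl) ⇒-refl

erase◇-sound : ∀ {φ} → ⊢CK φ → ⊢CK□ (erase◇ φ)
erase◇-sound K        = K
erase◇-sound S        = S
erase◇-sound ∧E₁      = ∧E₁
erase◇-sound ∧E₂      = ∧E₂
erase◇-sound ∧I       = ∧I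
erase◇-sound ∨I₁      = ∨I₁
erase◇-sound ∨I₂      = ∨I₂
erase◇-sound ∨E       = ∨E
erase◇-sound ⊥E       = ⊥E
erase◇-sound (MP d e) = MP (erase◇-sound d) (erase◇-sound e)
erase◇-sound CM□      = CM□
erase◇-sound CC□      = CC□
erase◇-sound CN□      = CN□
erase◇-sound CN◇      = ⇒-refl
erase◇-sound CK◇      = MP K ⇒-refl
erase◇-sound (RA□ d)  = RA□ (erase◇-sound d)
erase◇-sound (RC□ d)  = RC□ (erase◇-sound d)
erase◇-sound (RA◇ _)  = ⇔-refl
erase◇-sound (RC◇ _)  = ⇔-refl

ι-sound : ∀ {φ} → ⊢CK□ φ → ⊢CK (ι φ)
ι-sound K        = K
ι-sound S        = S
ι-sound ∧E₁      = ∧E₁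
ι-sound ∧E₂      = ∧E₂
ι-sound ∧I       = ∧I
ι-sound ∨I₁      = ∨I₁
ι-sound ∨I₂      = ∨I₂
ι-sound ∨E       = ∨E
ι-sound ⊥E       = ⊥E
ι-sound (MP d e) = MP (ι-sound d) (ι-sound e)
ι-sound CM□      = CM□
ι-sound CC□      = CC□
ι-sound CN□      = CN□
ι-sound (RA□ d)  = RA□ (ι-sound d)
ι-sound (RC□ d)  = RC□ (ι-sound d)

theorem6 : (φ : FmB) → (⊢CK (ι φ) → ⊢CK□ φ) × (⊢CK□ φ → ⊢CK (ι φ))
theorem6 φ = (λ d → subst ⊢CK□ (erase◇-ι φ) (erase◇-sound d)) , ι-sound
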